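{- For all positive integers $a,b$, $e[ab]\le e[a]+e[b]$.
   Context: For an integer $n\ge1$, $e[n]$ is the expected number of fair coin tosses used by the bit-efficient scheme for choosing one of $n$ options uniformly. The scheme maintains a set of undecided equally likely toss sequences of the current length $t$ (probability $2^{ -t}$ each), starting with the empty sequence; if $n=1$, it stops immediately, so $e[1]=0$. After each toss, each undecided sequence splits into its two extensions. If there are now at least $n$ undecided sequences, $n$ of them are assigned one to each option, and the process stops if the observed sequence is among them; the rest remain undecided. Thus after $t$ tosses exactly $2^t\bmod n$ sequences are undecided. -}

module Defs where

open import Data.Nat using (ℕ; zero; suc; _^_; _%_)
open import Data.Integer using (+_)
open import Data.Rational using (ℚ; 0ℚ; 1ℚ; ½; _+_; _*_)

-- Number of undecided toss sequences after t tosses when choosing among n options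
-- (n ≥ 1): exactly 2^t mod n.  (The n = 0 clause is a dummy; only n ≥ 1 is used.)
undecided : ℕ → ℕ → ℕ
undecided zero    t = 0
undecided (suc m) t = (2 ^ t) % suc m

halfPow : ℕ → ℚ
halfPow zero    = 1ℚ
halfPow (suc t) = ½ * halfPow t

-- P(process has not stopped after t tosses) = undecided n t / 2^t
notStopped : ℕ → ℕ → ℚ
notStopped n t = (+ undecided n t / 1) * halfPow t
  where open Data.Rational using (_/_)

-- Partial sum  Σ_{t < T} P(not stopped after t tosses).
-- e[n] = Σ_{t ≥ 0} P(tosses > t) = lim_{T → ∞} ePartial n T  (nonnegative terms, convergent).
ePartial : ℕ → ℕ → ℚ
ePartial n zero    = 0ℚ
ePartial n (suc T) = ePartial n T + notStopped n T

-- Multiplying by 2^T keeps everything in ℕ: ePartial n T = tossSum n 1 T / 2^T, where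
-- tossSum n x T = Σ_{t<T} 2^(T∸t) · (x·2^t mod n) is the scaled, truncated cost of the scheme
-- for n started from x undecided sequences; it is subadditive in x.  Writing
-- y mod ab = y mod a + a·(⌊y/a⌋ mod b), the scheme for ab on y is dominated by the scheme for a
-- on y together with a copies of the scheme for b on the ⌊y/a⌋ complete a-blocks; the y mod a
-- sequences left over by a, which spill into new blocks when doubled, each pay for a fresh
-- scheme for b.  Induction on T gives
--   tossSum ab y T ≤ tossSum a y T + a · tossSum b ⌊y/a⌋ T + (y mod a) · tossSum b 1 T,
-- and y = 1 yields the inequality already between the partial sums with the same T.
module Submission where

module TossSum where

  open import Data.Nat
  open import Data.Nat.Properties
  open import Data.Nat.DivMod
  open import Data.Nat.Divisibility using (divides-refl)
  open import Data.Nat.Tactic.RingSolver using (solve-∀)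
  open import Relation.Binary.PropositionalEquality
  open import Algebra.Properties.CommutativeSemigroup +-commutativeSemigroup
    using () renaming (interchange to +-interchange)

  [m+n]%o≤m%o+n%o : ∀ m n o .{{_ : NonZero o}} → (m + n) % o ≤ m % o + n % o
  [m+n]%o≤m%o+n%o m n o = begin
    (m + n) % o         ≡⟨ %-distribˡ-+ m n o ⟩
    (m % o + n % o) % o ≤⟨ m%n≤m (m % o + n % o) o ⟩
    m % o + n % o       ∎
    where open ≤-Reasoning

  m%[n*o]≡m%n+n*[m/n%o] : ∀ m n o .{{_ : NonZero n}} .{{_ : NonZero o}} .{{_ : NonZero (n * o)}} →
                          m % (n * o) ≡ m % n + n * (m / n % o)
  m%[n*o]≡m%n+n*[m/n%o] m n o = begin
    m % (n * o)                           ≡⟨ %-congʳ (*-comm n o) ⟩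
    m % (o * n)                           ≡⟨ m≡m%n+[m/n]*n (m % (o * n)) n ⟩
    m % (o * n) % n + m % (o * n) / n * n ≡⟨ cong₂ (λ r q → r + q * n)
                                                   (m∣n⇒o%n%m≡o%m n (o * n) m (divides-refl o))
                                                   (m%[n*o]/o≡m/o%n m o n) ⟩
    m % n + m / n % o * n                 ≡⟨ cong (m % n +_) (*-comm (m / n % o) n) ⟩
    m % n + n * (m / n % o)               ∎
    where
    open ≡-Reasoning
    instance _ = m*n≢0 o n

  module _ (n : ℕ) .{{_ : NonZero n}} where

    tossSum : ℕ → ℕ → ℕ
    tossSum x zero    = 0
    tossSum x (suc T) = 2 * (tossSum x T + x * 2 ^ T % n)

    tossSum-0≡0 : ∀ T → tossSum 0 T ≡ 0
    tossSum-0≡0 zero    = refl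
    tossSum-0≡0 (suc T) = cong₂ (λ s r → 2 * (s + r)) (tossSum-0≡0 T) (m*n%n≡0 0 n)

    tossSum-firstToss : ∀ x T → tossSum x (suc T) ≡ x % n * 2 ^ suc T + tossSum (2 * x) T
    tossSum-firstToss x zero = begin
      2 * (0 + x * 1 % n) ≡⟨ cong (λ y → 2 * (y % n)) (*-identityʳ x) ⟩
      2 * (x % n)         ≡⟨ 2*r≡r*2+0 (x % n) ⟩
      x % n * 2 + 0       ∎
      where
      open ≡-Reasoning
      2*r≡r*2+0 : ∀ r → 2 * r ≡ r * 2 + 0
      2*r≡r*2+0 = solve-∀
    tossSum-firstToss x (suc T) = begin
      2 * (tossSum x (suc T) + x * 2 ^ suc T % n)
        ≡⟨ cong₂ (λ s y → 2 * (s + y % n)) (tossSum-firstToss x T) (x*[2*y]≡2*x*y x (2 ^ T)) ⟩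
      2 * (r * 2 ^ suc T + tossSum (2 * x) T + 2 * x * 2 ^ T % n)
        ≡⟨ 2*[a*b+c+d]≡a*[2*b]+2*[c+d] r (2 ^ suc T) _ _ ⟩
      r * 2 ^ suc (suc T) + tossSum (2 * x) (suc T) ∎
      where
      open ≡-Reasoning
      r = x % n
      x*[2*y]≡2*x*y : ∀ x y → x * (2 * y) ≡ 2 * x * y
      x*[2*y]≡2*x*y = solve-∀
      2*[a*b+c+d]≡a*[2*b]+2*[c+d] : ∀ a b c d → 2 * (a * b + c + d) ≡ a * (2 * b) + 2 * (c + d)
      2*[a*b+c+d]≡a*[2*b]+2*[c+d] = solve-∀

    tossSum-subadditive : ∀ x y T → tossSum (x + y) T ≤ tossSum x T + tossSum y T
    tossSum-subadditive x y zero    = z≤n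
    tossSum-subadditive x y (suc T) = begin
      2 * (tossSum (x + y) T + (x + y) * 2 ^ T % n)
        ≤⟨ *-monoʳ-≤ 2 (+-mono-≤ (tossSum-subadditive x y T) residue-subadditive) ⟩
      2 * ((tossSum x T + tossSum y T) + (rx + ry))
        ≡⟨ cong (2 *_) (+-interchange (tossSum x T) (tossSum y T) rx ry) ⟩
      2 * ((tossSum x T + rx) + (tossSum y T + ry))
        ≡⟨ *-distribˡ-+ 2 (tossSum x T + rx) (tossSum y T + ry) ⟩
      tossSum x (suc T) + tossSum y (suc T) ∎
      where
      open ≤-Reasoning
      rx = x * 2 ^ T % n
      ry = y * 2 ^ T % n
      residue-subadditive : (x + y) * 2 ^ T % n ≤ rx + ry
      residue-subadditive = begin
        (x + y) * 2 ^ T % n         ≡⟨ cong (_% n) (*-distribʳ-+ (2 ^ T) x y) ⟩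
        (x * 2 ^ T + y * 2 ^ T) % n ≤⟨ [m+n]%o≤m%o+n%o (x * 2 ^ T) (y * 2 ^ T) n ⟩
        rx + ry                     ∎

    tossSum-*-≤ : ∀ k x T → tossSum (k * x) T ≤ k * tossSum x T
    tossSum-*-≤ zero    x T = ≤-reflexive (tossSum-0≡0 T)
    tossSum-*-≤ (suc k) x T = begin
      tossSum (x + k * x) T           ≤⟨ tossSum-subadditive x (k * x) T ⟩
      tossSum x T + tossSum (k * x) T ≤⟨ +-monoʳ-≤ (tossSum x T) (tossSum-*-≤ k x T) ⟩
      tossSum x T + k * tossSum x T   ∎
      where open ≤-Reasoning

    tossSum-doubling : ∀ x T → 2 * tossSum x T ≤ tossSum x (suc T)
    tossSum-doubling x T = *-monoʳ-≤ 2 (m≤m+n (tossSum x T) (x * 2 ^ T % n))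

  module _ (a b : ℕ) .{{_ : NonZero a}} .{{_ : NonZero b}} where

    tossSum-carry : ∀ u v T →
      a * tossSum b ((v + u * a) / a) T + (v + u * a) % a * tossSum b 1 T ≤
      a * tossSum b u T + v * tossSum b 1 T
    tossSum-carry u v T = begin
      a * tossSum b ((v + u * a) / a) T + (v + u * a) % a * E
        ≡⟨ cong₂ (λ q r → a * tossSum b q T + r * E) quotient ([m+kn]%n≡m%n v u a) ⟩
      a * tossSum b (v / a + u) T + v % a * E
        ≤⟨ +-monoˡ-≤ (v % a * E) (*-monoʳ-≤ a (tossSum-subadditive b (v / a) u T)) ⟩
      a * (tossSum b (v / a) T + tossSum b u T) + v % a * E
        ≤⟨ +-monoˡ-≤ (v % a * E) (*-monoʳ-≤ a (+-monoˡ-≤ (tossSum b u T) scaling)) ⟩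
      a * (v / a * E + tossSum b u T) + v % a * E
        ≡⟨ rearrange a (v / a) E (tossSum b u T) (v % a) ⟩
      a * tossSum b u T + (v % a + v / a * a) * E
        ≡⟨ cong (λ w → a * tossSum b u T + w * E) (sym (m≡m%n+[m/n]*n v a)) ⟩
      a * tossSum b u T + v * E ∎
      where
      open ≤-Reasoning
      E = tossSum b 1 T
      quotient : (v + u * a) / a ≡ v / a + u
      quotient = trans (+-distrib-/-∣ʳ v (divides-refl u)) (cong (v / a +_) (m*n/n≡m u a))
      scaling : tossSum b (v / a) T ≤ v / a * E
      scaling = subst (λ k → tossSum b k T ≤ v / a * E) (*-identityʳ (v / a)) (tossSum-*-≤ b (v / a) 1 T)
      rearrange : ∀ a q E S r → a * (q * E + S) + r * E ≡ a * S + (r + q * a) * E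
      rearrange = solve-∀

    private instance
      ab≢0 : NonZero (a * b)
      ab≢0 = m*n≢0 a b

    tossSum-product : ∀ y T →
      tossSum (a * b) y T ≤ tossSum a y T + (a * tossSum b (y / a) T + y % a * tossSum b 1 T)
    tossSum-product y zero    = z≤n
    tossSum-product y (suc T) = begin
      tossSum (a * b) y (suc T)
        ≡⟨ tossSum-firstToss (a * b) y T ⟩
      y % (a * b) * P + tossSum (a * b) (2 * y) T
        ≤⟨ +-monoʳ-≤ (y % (a * b) * P) (tossSum-product (2 * y) T) ⟩
      y % (a * b) * P + (A + (a * tossSum b (2 * y / a) T + 2 * y % a * E))
        ≡⟨ cong₂ (λ z w → z * P + (A + (a * tossSum b (w / a) T + w % a * E)))
                 (m%[n*o]≡m%n+n*[m/n%o] y a b) double-divMod ⟩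
      (r + a * s) * P + (A + (a * tossSum b ((2 * r + 2 * q * a) / a) T + (2 * r + 2 * q * a) % a * E))
        ≤⟨ +-monoʳ-≤ ((r + a * s) * P) (+-monoʳ-≤ A (tossSum-carry (2 * q) (2 * r) T)) ⟩
      (r + a * s) * P + (A + (a * B + 2 * r * E))
        ≡⟨ rearrange r a s P A B E ⟩
      (r * P + A) + (a * (s * P + B) + r * (2 * E))
        ≤⟨ +-monoʳ-≤ (r * P + A) (+-monoʳ-≤ (a * (s * P + B)) (*-monoʳ-≤ r (tossSum-doubling b 1 T))) ⟩
      (r * P + A) + (a * (s * P + B) + r * tossSum b 1 (suc T))
        ≡⟨ cong₂ (λ z w → z + (a * w + r * tossSum b 1 (suc T)))
                 (sym (tossSum-firstToss a y T)) (sym (tossSum-firstToss b q T)) ⟩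
      tossSum a y (suc T) + (a * tossSum b q (suc T) + r * tossSum b 1 (suc T)) ∎
      where
      open ≤-Reasoning
      P = 2 ^ suc T
      r = y % a
      q = y / a
      s = q % b
      A = tossSum a (2 * y) T
      B = tossSum b (2 * q) T
      E = tossSum b 1 T
      2*[r+q*a]≡2*r+2*q*a : ∀ r q a → 2 * (r + q * a) ≡ 2 * r + 2 * q * a
      2*[r+q*a]≡2*r+2*q*a = solve-∀
      double-divMod : 2 * y ≡ 2 * r + 2 * q * a
      double-divMod = trans (cong (2 *_) (m≡m%n+[m/n]*n y a)) (2*[r+q*a]≡2*r+2*q*a r q a)
      rearrange : ∀ r a s P A B E →
        (r + a * s) * P + (A + (a * B + 2 * r * E)) ≡ (r * P + A) + (a * (s * P + B) + r * (2 * E))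
      rearrange = solve-∀

    tossSum-product-1 : ∀ T → tossSum (a * b) 1 T ≤ tossSum a 1 T + tossSum b 1 T
    tossSum-product-1 T = begin
      tossSum (a * b) 1 T
        ≤⟨ tossSum-product 1 T ⟩
      tossSum a 1 T + (a * tossSum b (1 / a) T + 1 % a * tossSum b 1 T)
        ≤⟨ +-monoʳ-≤ (tossSum a 1 T) (tossSum-carry 0 1 T) ⟩
      tossSum a 1 T + (a * tossSum b 0 T + 1 * tossSum b 1 T)
        ≡⟨ cong₂ (λ z w → tossSum a 1 T + (a * z + w)) (tossSum-0≡0 b T) (*-identityˡ (tossSum b 1 T)) ⟩
      tossSum a 1 T + (a * 0 + tossSum b 1 T)
        ≡⟨ cong (λ z → tossSum a 1 T + (z + tossSum b 1 T)) (*-zeroʳ a) ⟩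
      tossSum a 1 T + tossSum b 1 T ∎
      where open ≤-Reasoning

module PartialExpectation where

  open import Defs
  open import Data.Nat as ℕ using (ℕ; zero; suc)
  import Data.Nat.Properties as ℕ
  open import Data.Nat.Coprimality using (1-coprimeTo; sym)
  open import Data.Integer as ℤ using (+_; +≤+)
  import Data.Integer.Properties as ℤ
  open import Data.Integer.Tactic.RingSolver using (solve-∀)
  open import Data.Rational
  open import Data.Rational.Properties
  open import Data.Rational.Solver using (module +-*-Solver)
  open import Data.Rational.Unnormalised as ℚᵘ using (mkℚᵘ; *≡*; *≤*)
  import Data.Rational.Unnormalised.Properties as ℚᵘ
  open import Relation.Binary.PropositionalEquality hiding (sym)
  import Relation.Binary.PropositionalEquality as ≡
  open TossSum using (tossSum; tossSum-product-1)

  toℚ : ℕ → ℚ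
  toℚ n = + n / 1

  toℚᵘ-toℚ : ∀ n → toℚᵘ (toℚ n) ≡ mkℚᵘ (+ n) 0
  toℚᵘ-toℚ n = cong toℚᵘ (normalize-coprime (sym (1-coprimeTo n)))

  toℚ-+ : ∀ m n → toℚ (m ℕ.+ n) ≡ toℚ m + toℚ n
  toℚ-+ m n = toℚᵘ-injective (begin
    toℚᵘ (toℚ (m ℕ.+ n))           ≡⟨ toℚᵘ-toℚ (m ℕ.+ n) ⟩
    mkℚᵘ (+ (m ℕ.+ n)) 0           ≈⟨ *≡* (trans (cong (ℤ._* + 1) (ℤ.pos-+ m n)) (*-unit (+ m) (+ n))) ⟩
    mkℚᵘ (+ m) 0 ℚᵘ.+ mkℚᵘ (+ n) 0 ≡⟨ cong₂ ℚᵘ._+_ (toℚᵘ-toℚ m) (toℚᵘ-toℚ n) ⟨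
    toℚᵘ (toℚ m) ℚᵘ.+ toℚᵘ (toℚ n) ≈⟨ toℚᵘ-homo-+ (toℚ m) (toℚ n) ⟨
    toℚᵘ (toℚ m + toℚ n)           ∎)
    where
    open ℚᵘ.≃-Reasoning
    *-unit : ∀ i j → (i ℤ.+ j) ℤ.* + 1 ≡ (i ℤ.* + 1 ℤ.+ j ℤ.* + 1) ℤ.* + 1
    *-unit = solve-∀

  toℚ-mono-≤ : ∀ {m n} → m ℕ.≤ n → toℚ m ≤ toℚ n
  toℚ-mono-≤ {m} {n} m≤n = toℚᵘ-cancel-≤ (subst₂ ℚᵘ._≤_ (≡.sym (toℚᵘ-toℚ m)) (≡.sym (toℚᵘ-toℚ n))
    (*≤* (ℤ.*-monoʳ-≤-nonNeg (+ 1) (+≤+ m≤n))))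

  toℚ-double-*-½ : ∀ k p → toℚ (2 ℕ.* k) * (½ * p) ≡ toℚ k * p
  toℚ-double-*-½ k p = begin
    toℚ (k ℕ.+ (k ℕ.+ 0)) * (½ * p) ≡⟨ cong (λ j → toℚ (k ℕ.+ j) * (½ * p)) (ℕ.+-identityʳ k) ⟩
    toℚ (k ℕ.+ k) * (½ * p)         ≡⟨ cong (_* (½ * p)) (toℚ-+ k k) ⟩
    (toℚ k + toℚ k) * (½ * p)       ≡⟨ [x+x]*[c*p]≡x*[[c+c]*p] (toℚ k) ½ p ⟩
    toℚ k * ((½ + ½) * p)           ≡⟨ cong (toℚ k *_) (*-identityˡ p) ⟩
    toℚ k * p                       ∎
    where
    open ≡-Reasoning
    open +-*-Solver
    [x+x]*[c*p]≡x*[[c+c]*p] : ∀ x c p → (x + x) * (c * p) ≡ x * ((c + c) * p)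
    [x+x]*[c*p]≡x*[[c+c]*p] = solve 3 (λ x c p → (x :+ x) :* (c :* p) := x :* ((c :+ c) :* p)) refl

  halfPow-nonNeg : ∀ T → NonNegative (halfPow T)
  halfPow-nonNeg zero    = _
  halfPow-nonNeg (suc T) = nonNeg*nonNeg⇒nonNeg ½ (halfPow T) {{halfPow-nonNeg T}}

  ePartial≡tossSum*halfPow : ∀ n .{{_ : ℕ.NonZero n}} T → ePartial n T ≡ toℚ (tossSum n 1 T) * halfPow T
  ePartial≡tossSum*halfPow n         zero    = refl
  ePartial≡tossSum*halfPow n@(suc _) (suc T) = begin
    ePartial n T + toℚ r * p                    ≡⟨ cong (_+ toℚ r * p) (ePartial≡tossSum*halfPow n T) ⟩
    toℚ S * p + toℚ r * p                       ≡⟨ *-distribʳ-+ p (toℚ S) (toℚ r) ⟨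
    (toℚ S + toℚ r) * p                         ≡⟨ cong (_* p) (toℚ-+ S r) ⟨
    toℚ (S ℕ.+ r) * p                           ≡⟨ toℚ-double-*-½ (S ℕ.+ r) p ⟨
    toℚ (2 ℕ.* (S ℕ.+ r)) * (½ * p)             ≡⟨ cong (λ j → toℚ (2 ℕ.* (S ℕ.+ j ℕ.% n)) * (½ * p))
                                                         (ℕ.*-identityˡ (2 ℕ.^ T)) ⟨
    toℚ (tossSum n 1 (suc T)) * halfPow (suc T) ∎
    where
    open ≡-Reasoning
    p = halfPow T
    S = tossSum n 1 T
    r = 2 ℕ.^ T ℕ.% n

  ePartial-product : ∀ a b .{{_ : ℕ.NonZero a}} .{{_ : ℕ.NonZero b}} T →
                     ePartial (a ℕ.* b) T ≤ ePartial a T + ePartial b T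
  ePartial-product a b T = begin
    ePartial (a ℕ.* b) T            ≡⟨ ePartial≡tossSum*halfPow (a ℕ.* b) T ⟩
    toℚ (tossSum (a ℕ.* b) 1 T) * p ≤⟨ *-monoʳ-≤-nonNeg p (toℚ-mono-≤ (tossSum-product-1 a b T)) ⟩
    toℚ (Sa ℕ.+ Sb) * p             ≡⟨ cong (_* p) (toℚ-+ Sa Sb) ⟩
    (toℚ Sa + toℚ Sb) * p           ≡⟨ *-distribʳ-+ p (toℚ Sa) (toℚ Sb) ⟩
    toℚ Sa * p + toℚ Sb * p         ≡⟨ cong₂ _+_ (ePartial≡tossSum*halfPow a T) (ePartial≡tossSum*halfPow b T) ⟨
    ePartial a T + ePartial b T     ∎
    where
    open ≤-Reasoning
    p = halfPow T
    Sa = tossSum a 1 T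
    Sb = tossSum b 1 T
    instance
      _ = halfPow-nonNeg T
      _ = ℕ.m*n≢0 a b

open import Defs
open import Data.Nat using (ℕ; _*_)
open import Data.Product using (∃-syntax)
open import Data.Rational using (ℚ; 0ℚ; _+_; _<_; _≤_)
import Data.Nat as N

open import Data.Product using (_,_)
open import Data.Rational.Properties using (module ≤-Reasoning; <⇒≤; +-monoʳ-≤; +-identityʳ)
open PartialExpectation using (ePartial-product)

proposition11 : (a b : ℕ) → 1 N.≤ a → 1 N.≤ b →
    (ε : ℚ) → 0ℚ < ε → (T : ℕ) →
    ∃[ T′ ] ePartial (a * b) T ≤ (ePartial a T′ + ePartial b T′) + ε
proposition11 N.zero      _         () _  _ _   _
proposition11 (N.suc _)   N.zero    _  () _ _   _
proposition11 a@(N.suc _) b@(N.suc _) _  _  ε 0<ε T = T , (begin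
  ePartial (a * b) T                 ≤⟨ ePartial-product a b T ⟩
  ePartial a T + ePartial b T        ≡⟨ +-identityʳ (ePartial a T + ePartial b T) ⟨
  (ePartial a T + ePartial b T) + 0ℚ ≤⟨ +-monoʳ-≤ (ePartial a T + ePartial b T) (<⇒≤ 0<ε) ⟩
  (ePartial a T + ePartial b T) + ε  ∎)
  where open ≤-Reasoning
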